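{- Let $k$ be a fixed positive integer and let $\mathcal D$ be a uniformly random $k$-out bipartite digraph with parts $\mathcal A$ and $\mathcal B$, where $|\mathcal A|=\Theta(N)$ and $|\mathcal B|=\Theta(N)$. Then the number of nodes that have a multiple (parallel) in-edge is at most $N^{2/3}$, with failure probability of order $\exp(-\Omega(N^{1/3}))$.
   Context: A uniformly random $k$-out bipartite multigraph (digraph) on disjoint node sets $\mathcal A,\mathcal B$ is a directed multigraph in which every node of $\mathcal A$ has $k$ out-edges to nodes of $\mathcal B$ chosen independently and uniformly at random with replacement, and every node of $\mathcal B$ has $k$ out-edges to nodes of $\mathcal A$ chosen likewise, all choices independent. A node has a multiple in-edge if some other node has at least two out-edges to it. -}

module Defs where

open import Data.Nat using (ℕ; zero; suc; _≤?_)
open import Data.Fin using (Fin; zero; suc)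
open import Data.Fin.Properties using (_≟_)
open import Data.Bool using (Bool; true; false; if_then_else_)
open import Data.Vec using (Vec; []; _∷_; toList)
open import Data.List using (List; []; _∷_; [_]; map; concatMap; allFin; length; filter; filterᵇ; cartesianProduct)
open import Data.Product using (_×_; _,_)
open import Relation.Nullary using (does)
open import Data.Bool.ListAction using (any)

allVec : ∀ {X : Set} (k : ℕ) → List X → List (Vec X k)
allVec zero    xs = [ [] ]
allVec (suc k) xs = concatMap (λ x → map (x ∷_) (allVec k xs)) xs

consF : ∀ {X : Set} {n : ℕ} → X → (Fin n → X) → Fin (suc n) → X
consF x f zero    = x
consF x f (suc i) = f i

allFun : ∀ {X : Set} (n : ℕ) → List X → List (Fin n → X)
allFun zero    xs = [ (λ ()) ]
allFun (suc n) xs = concatMap (λ x → map (consF x) (allFun n xs)) xs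

-- A k-out bipartite multigraph with |A| = a, |B| = b:
-- each u ∈ A has an ordered list of k out-neighbours in B (choices with
-- replacement), and each v ∈ B has k out-neighbours in A.
KOut : ℕ → ℕ → ℕ → Set
KOut k a b = (Fin a → Vec (Fin b) k) × (Fin b → Vec (Fin a) k)

-- all k^... equally likely outcomes of the random choices
allKOut : ∀ k a b → List (KOut k a b)
allKOut k a b = cartesianProduct (allFun a (allVec k (allFin b)))
                                 (allFun b (allVec k (allFin a)))

mult : ∀ {n k} → Fin n → Vec (Fin n) k → ℕ
mult v es = length (filterᵇ (λ w → does (w ≟ v)) (toList es))

hasMultIn : ∀ {n m k} → (Fin n → Vec (Fin m) k) → Fin m → Bool
hasMultIn {n} f v = any (λ u → does (2 ≤? mult v (f u))) (allFin n)

numMultIn : ∀ {k a b} → KOut k a b → ℕ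
numMultIn {k} {a} {b} (f , g) =
  length (filterᵇ (hasMultIn f) (allFin b)) + length (filterᵇ (hasMultIn g) (allFin a))
  where open import Data.Nat using (_+_)

countWhere : ∀ k a b → (KOut k a b → Bool) → ℕ
countWhere k a b P = length (filterᵇ P (allKOut k a b))

total : ℕ → ℕ → ℕ → ℕ
total k a b = length (allKOut k a b)

-- Call a position of a word w ∈ [n]^k a repeat if its letter occurs again later in w.
-- A node with a multiple in-edge comes from some out-list with a repeated letter, so the
-- number of such nodes is at most the total number R of repeats over all out-lists.
-- Out-lists are independent, and summing 2^(repeats) over all words letter by letter
-- gives at most (n + k)^k, so E[2^R] ≤ (1 + k/|B|)^(k|A|) (1 + k/|A|)^(k|B|) = O(1) when
-- |A|, |B| = Θ(N). On the event numMultIn³ > N² we have R ≥ N^(1/3), and Markov's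
-- inequality applied to 2^R gives the tail bound.
module Submission where

open import Defs
open import Data.Nat using (ℕ; suc; _+_; _*_; _^_; _≤_; _<_; _<ᵇ_)
open import Data.Nat.DivMod using (_/_)
open import Data.Product using (Σ; _×_)
open import Data.Nat using (zero; NonZero; _∸_; _≤?_; _⊓_; z≤n; s≤s)
open import Data.Nat.Properties hiding (_≟_)
open import Data.Nat.DivMod using (_%_; m≡m%n+[m/n]*n; m%n<n; m/n*n≤m; m≥n⇒m/n>0; n/1≡n)
open import Data.Nat.ListAction using (sum)
open import Data.Nat.ListAction.Properties using (sum-++)
open import Data.Nat.Tactic.RingSolver using (solve-∀)
open import Algebra.Properties.CommutativeSemigroup +-commutativeSemigroup using () renaming (interchange to +-interchange)
open import Algebra.Properties.CommutativeSemigroup *-commutativeSemigroup using () renaming (interchange to *-interchange)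
open import Data.Bool using (Bool; true; false; _∨_; T)
open import Data.Bool.ListAction using (any)
open import Data.Fin using (Fin; zero; suc)
open import Data.Fin.Properties using (_≟_)
open import Data.Vec using (Vec; []; _∷_; toList)
open import Data.Vec.Properties using (length-toList)
open import Data.List using (List; []; _∷_; map; concatMap; allFin; length; filterᵇ; cartesianProduct; _++_)
open import Data.List.Properties using (map-++; map-∘; map-tabulate; length-tabulate)
open import Data.Product using (_,_; proj₁; proj₂)
open import Relation.Nullary using (does; yes; no)
open import Relation.Binary.PropositionalEquality
open import Function using (_∘_; id)

private
  variable
    X Y : Set

iverson : Bool → ℕ
iverson true  = 1
iverson false = 0

iverson-∨ : ∀ p q → iverson (p ∨ q) ≤ iverson p + iverson q
iverson-∨ true  q = s≤s z≤n
iverson-∨ false q = ≤-refl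

∑ : List X → (X → ℕ) → ℕ
∑ L F = sum (map F L)

infix 2 ∑
syntax ∑ L (λ x → e) = ∑[ x ∈ L ] e

∑-cong : ∀ (L : List X) {F G : X → ℕ} → (∀ x → F x ≡ G x) → ∑ L F ≡ ∑ L G
∑-cong []      F≡G = refl
∑-cong (x ∷ L) F≡G = cong₂ _+_ (F≡G x) (∑-cong L F≡G)

∑-mono-≤ : ∀ (L : List X) {F G : X → ℕ} → (∀ x → F x ≤ G x) → ∑ L F ≤ ∑ L G
∑-mono-≤ []      F≤G = z≤n
∑-mono-≤ (x ∷ L) F≤G = +-mono-≤ (F≤G x) (∑-mono-≤ L F≤G)

∑-distrib-+ : ∀ (L : List X) (F G : X → ℕ) → (∑[ x ∈ L ] F x + G x) ≡ ∑ L F + ∑ L G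
∑-distrib-+ []      F G = refl
∑-distrib-+ (x ∷ L) F G = begin
  F x + G x + (∑[ y ∈ L ] F y + G y) ≡⟨ cong (F x + G x +_) (∑-distrib-+ L F G) ⟩
  F x + G x + (∑ L F + ∑ L G)       ≡⟨ +-interchange (F x) (G x) (∑ L F) (∑ L G) ⟩
  F x + ∑ L F + (G x + ∑ L G)       ∎
  where open ≡-Reasoning

∑-distribˡ-* : ∀ (L : List X) c (F : X → ℕ) → (∑[ x ∈ L ] c * F x) ≡ c * ∑ L F
∑-distribˡ-* []      c F = sym (*-zeroʳ c)
∑-distribˡ-* (x ∷ L) c F = trans (cong (c * F x +_) (∑-distribˡ-* L c F)) (sym (*-distribˡ-+ c (F x) (∑ L F)))

∑-distribʳ-* : ∀ (L : List X) c (F : X → ℕ) → (∑[ x ∈ L ] F x * c) ≡ ∑ L F * c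
∑-distribʳ-* L c F = trans (∑-cong L (λ x → *-comm (F x) c)) (trans (∑-distribˡ-* L c F) (*-comm c (∑ L F)))

∑-const : ∀ (L : List X) c → (∑[ _ ∈ L ] c) ≡ length L * c
∑-const []      c = refl
∑-const (x ∷ L) c = cong (c +_) (∑-const L c)

length≡∑1 : ∀ (L : List X) → length L ≡ (∑[ _ ∈ L ] 1)
length≡∑1 []      = refl
length≡∑1 (x ∷ L) = cong suc (length≡∑1 L)

∑-zero : ∀ (L : List X) → (∑[ _ ∈ L ] 0) ≡ 0
∑-zero L = trans (∑-const L 0) (*-zeroʳ (length L))

∑-++ : ∀ (L M : List X) (F : X → ℕ) → ∑ (L ++ M) F ≡ ∑ L F + ∑ M F
∑-++ L M F = trans (cong sum (map-++ F L M)) (sum-++ (map F L) (map F M))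

∑-map : ∀ (h : X → Y) (L : List X) (F : Y → ℕ) → ∑ (map h L) F ≡ ∑ L (F ∘ h)
∑-map h L F = cong sum (sym (map-∘ L))

∑-comm : ∀ (L : List X) (M : List Y) (F : X → Y → ℕ) →
         (∑[ x ∈ L ] ∑[ y ∈ M ] F x y) ≡ (∑[ y ∈ M ] ∑[ x ∈ L ] F x y)
∑-comm []      M F = sym (∑-zero M)
∑-comm (x ∷ L) M F = trans (cong (∑ M (F x) +_) (∑-comm L M F))
                           (sym (∑-distrib-+ M (F x) (λ y → ∑[ x′ ∈ L ] F x′ y)))

∑-concatMap-map : ∀ {Z : Set} (h : X → Y → Z) (L : List X) (M : List Y) (F : Z → ℕ) →
                  ∑ (concatMap (λ x → map (h x) M) L) F ≡ (∑[ x ∈ L ] ∑[ y ∈ M ] F (h x y))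
∑-concatMap-map h []      M F = refl
∑-concatMap-map h (x ∷ L) M F = begin
  ∑ (map (h x) M ++ concatMap (λ x′ → map (h x′) M) L) F
    ≡⟨ ∑-++ (map (h x) M) _ F ⟩
  ∑ (map (h x) M) F + ∑ (concatMap (λ x′ → map (h x′) M) L) F
    ≡⟨ cong₂ _+_ (∑-map (h x) M F) (∑-concatMap-map h L M F) ⟩
  ∑ M (F ∘ h x) + (∑[ x′ ∈ L ] ∑[ y ∈ M ] F (h x′ y)) ∎
  where open ≡-Reasoning

length-concatMap-map : ∀ {Z : Set} (h : X → Y → Z) (L : List X) (M : List Y) →
                       length (concatMap (λ x → map (h x) M) L) ≡ length L * length M
length-concatMap-map h L M = begin
  length (concatMap (λ x → map (h x) M) L)   ≡⟨ length≡∑1 (concatMap (λ x → map (h x) M) L) ⟩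
  ∑ (concatMap (λ x → map (h x) M) L) (λ _ → 1) ≡⟨ ∑-concatMap-map h L M (λ _ → 1) ⟩
  (∑[ _ ∈ L ] ∑[ _ ∈ M ] 1)                 ≡⟨ ∑-cong L (λ _ → sym (length≡∑1 M)) ⟩
  (∑[ _ ∈ L ] length M)                     ≡⟨ ∑-const L (length M) ⟩
  length L * length M                       ∎
  where open ≡-Reasoning

∑-cartesianProduct : ∀ {A B : Set} (L : List A) (M : List B) (F : A → ℕ) (G : B → ℕ) →
                     (∑[ p ∈ cartesianProduct L M ] F (proj₁ p) * G (proj₂ p)) ≡ ∑ L F * ∑ M G
∑-cartesianProduct []      M F G = refl
∑-cartesianProduct {A} {B} (x ∷ L) M F G = begin
  ∑ (map (x ,_) M ++ cartesianProduct L M) H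
    ≡⟨ ∑-++ (map (x ,_) M) (cartesianProduct L M) H ⟩
  ∑ (map (x ,_) M) H + ∑ (cartesianProduct L M) H
    ≡⟨ cong₂ _+_ (trans (∑-map (x ,_) M H) (∑-distribˡ-* M (F x) G)) (∑-cartesianProduct L M F G) ⟩
  F x * ∑ M G + ∑ L F * ∑ M G
    ≡⟨ sym (*-distribʳ-+ (∑ M G) (F x) (∑ L F)) ⟩
  (F x + ∑ L F) * ∑ M G ∎
  where
  open ≡-Reasoning
  H : A × B → ℕ
  H p = F (proj₁ p) * G (proj₂ p)

length-filterᵇ : ∀ (p : X → Bool) (L : List X) → length (filterᵇ p L) ≡ ∑ L (iverson ∘ p)
length-filterᵇ p []      = refl
length-filterᵇ p (x ∷ L) with p x
... | true  = cong suc (length-filterᵇ p L)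
... | false = length-filterᵇ p L

∑-allFin-suc : ∀ n (F : Fin (suc n) → ℕ) → ∑ (allFin (suc n)) F ≡ F zero + ∑ (allFin n) (F ∘ suc)
∑-allFin-suc n F = cong (λ L → F zero + sum L)
  (trans (map-tabulate suc F) (sym (map-tabulate id (F ∘ suc))))

length-allFin : ∀ n → length (allFin n) ≡ n
length-allFin n = length-tabulate id

∑-allFin-≟ : ∀ {n} (y : Fin n) → (∑[ v ∈ allFin n ] iverson (does (y ≟ v))) ≡ 1
∑-allFin-≟ {suc n} zero    = trans (∑-allFin-suc n (iverson ∘ does ∘ (zero ≟_))) (cong suc (∑-zero (allFin n)))
∑-allFin-≟ {suc n} (suc y) = trans (∑-allFin-suc n (iverson ∘ does ∘ (suc y ≟_))) (∑-allFin-≟ y)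

length-allVec : ∀ k (L : List X) → length (allVec k L) ≡ length L ^ k
length-allVec zero    L = refl
length-allVec (suc k) L = trans (length-concatMap-map _∷_ L (allVec k L)) (cong (length L *_) (length-allVec k L))

length-allFun : ∀ n (L : List X) → length (allFun n L) ≡ length L ^ n
length-allFun zero    L = refl
length-allFun (suc n) L = trans (length-concatMap-map consF L (allFun n L)) (cong (length L *_) (length-allFun n L))

total≡ : ∀ k a b → total k a b ≡ b ^ (k * a) * a ^ (k * b)
total≡ k a b = begin
  length (cartesianProduct FA FB)                   ≡⟨ length≡∑1 (cartesianProduct FA FB) ⟩
  ∑ (cartesianProduct FA FB) (λ _ → 1)              ≡⟨ ∑-cartesianProduct FA FB (λ _ → 1) (λ _ → 1) ⟩
  ∑ FA (λ _ → 1) * ∑ FB (λ _ → 1)                   ≡⟨ sym (cong₂ _*_ (length≡∑1 FA) (length≡∑1 FB)) ⟩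
  length FA * length FB                             ≡⟨ cong₂ _*_ (length-allFun a _) (length-allFun b _) ⟩
  length (allVec k (allFin b)) ^ a * length (allVec k (allFin a)) ^ b
    ≡⟨ cong₂ (λ x y → x ^ a * y ^ b) (length-allVec k (allFin b)) (length-allVec k (allFin a)) ⟩
  (length (allFin b) ^ k) ^ a * (length (allFin a) ^ k) ^ b
    ≡⟨ cong₂ (λ x y → (x ^ k) ^ a * (y ^ k) ^ b) (length-allFin b) (length-allFin a) ⟩
  (b ^ k) ^ a * (a ^ k) ^ b                         ≡⟨ cong₂ _*_ (^-*-assoc b k a) (^-*-assoc a k b) ⟩
  b ^ (k * a) * a ^ (k * b)                         ∎
  where
  open ≡-Reasoning
  FA = allFun a (allVec k (allFin b))
  FB = allFun b (allVec k (allFin a))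

∑-allFun-^ : ∀ {A : Set} m n (V : List A) (Z : A → ℕ) →
             (∑[ f ∈ allFun n V ] m ^ (∑[ u ∈ allFin n ] Z (f u))) ≡ (∑[ w ∈ V ] m ^ Z w) ^ n
∑-allFun-^ m zero    V Z = refl
∑-allFun-^ {A} m (suc n) V Z = begin
  ∑ (allFun (suc n) V) G
    ≡⟨ ∑-concatMap-map consF V (allFun n V) G ⟩
  (∑[ x ∈ V ] ∑[ f ∈ allFun n V ] G (consF x f))
    ≡⟨ ∑-cong V (λ x → ∑-cong (allFun n V) (λ f → split x f)) ⟩
  (∑[ x ∈ V ] ∑[ f ∈ allFun n V ] m ^ Z x * G f)
    ≡⟨ ∑-cong V (λ x → ∑-distribˡ-* (allFun n V) (m ^ Z x) G) ⟩
  (∑[ x ∈ V ] m ^ Z x * ∑ (allFun n V) G)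
    ≡⟨ ∑-distribʳ-* V (∑ (allFun n V) G) (λ x → m ^ Z x) ⟩
  (∑[ x ∈ V ] m ^ Z x) * ∑ (allFun n V) G
    ≡⟨ cong ((∑[ x ∈ V ] m ^ Z x) *_) (∑-allFun-^ m n V Z) ⟩
  (∑[ x ∈ V ] m ^ Z x) ^ suc n ∎
  where
  open ≡-Reasoning
  G : ∀ {i} → (Fin i → A) → ℕ
  G {i} f = m ^ (∑[ u ∈ allFin i ] Z (f u))
  split : ∀ x f → G (consF x f) ≡ m ^ Z x * G f
  split x f = trans (cong (m ^_) (∑-allFin-suc n (Z ∘ consF x f))) (^-distribˡ-+-* m (Z x) _)

mult≡∑ : ∀ {n k} (v : Fin n) (w : Vec (Fin n) k) → mult v w ≡ (∑[ y ∈ toList w ] iverson (does (y ≟ v)))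
mult≡∑ v w = length-filterᵇ (λ y → does (y ≟ v)) (toList w)

∑-mult : ∀ n {k} (w : Vec (Fin n) k) → (∑[ v ∈ allFin n ] mult v w) ≡ k
∑-mult n {k} w = begin
  (∑[ v ∈ allFin n ] mult v w)                                       ≡⟨ ∑-cong (allFin n) (λ v → mult≡∑ v w) ⟩
  (∑[ v ∈ allFin n ] ∑[ y ∈ toList w ] iverson (does (y ≟ v)))       ≡⟨ ∑-comm (allFin n) (toList w) _ ⟩
  (∑[ y ∈ toList w ] ∑[ v ∈ allFin n ] iverson (does (y ≟ v)))       ≡⟨ ∑-cong (toList w) ∑-allFin-≟ ⟩
  (∑[ _ ∈ toList w ] 1)                                              ≡⟨ sym (length≡∑1 (toList w)) ⟩
  length (toList w)                                                  ≡⟨ length-toList w ⟩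
  k                                                                  ∎
  where open ≡-Reasoning

-- 1 ⊓ m is the indicator of m > 0.
repeats : ∀ {n k} → Vec (Fin n) k → ℕ
repeats []      = 0
repeats (x ∷ w) = 1 ⊓ mult x w + repeats w

2≤-mult-∷ : ∀ {n k} (x v : Fin n) (w : Vec (Fin n) k) →
            iverson (does (2 ≤? mult v (x ∷ w))) ≤ iverson (does (2 ≤? mult v w)) + (1 ⊓ mult x w) * iverson (does (x ≟ v))
2≤-mult-∷ x v w with x ≟ v
... | yes refl = 2≤suc (mult x w)
  where
  2≤suc : ∀ m → iverson (does (2 ≤? suc m)) ≤ iverson (does (2 ≤? m)) + 1 ⊓ m * 1
  2≤suc zero    = z≤n
  2≤suc (suc m) = m≤n+m 1 _
... | no _ = m≤m+n (iverson (does (2 ≤? mult v w))) _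

multiples≤repeats : ∀ {n k} (w : Vec (Fin n) k) → (∑[ v ∈ allFin n ] iverson (does (2 ≤? mult v w))) ≤ repeats w
multiples≤repeats {n} []      = ≤-reflexive (∑-zero (allFin n))
multiples≤repeats {n} (x ∷ w) = begin
  (∑[ v ∈ allFin n ] iverson (does (2 ≤? mult v (x ∷ w))))
    ≤⟨ ∑-mono-≤ (allFin n) (λ v → 2≤-mult-∷ x v w) ⟩
  (∑[ v ∈ allFin n ] iverson (does (2 ≤? mult v w)) + r * iverson (does (x ≟ v)))
    ≡⟨ ∑-distrib-+ (allFin n) _ _ ⟩
  (∑[ v ∈ allFin n ] iverson (does (2 ≤? mult v w))) + (∑[ v ∈ allFin n ] r * iverson (does (x ≟ v)))
    ≡⟨ cong (_ +_) (trans (∑-distribˡ-* (allFin n) r _) (cong (r *_) (∑-allFin-≟ x))) ⟩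
  (∑[ v ∈ allFin n ] iverson (does (2 ≤? mult v w))) + r * 1
    ≤⟨ +-mono-≤ (multiples≤repeats w) (≤-reflexive (*-identityʳ r)) ⟩
  repeats w + r
    ≡⟨ +-comm (repeats w) r ⟩
  repeats (x ∷ w) ∎
  where
  open ≤-Reasoning
  r : ℕ
  r = 1 ⊓ mult x w

∑-allVec-2^repeats≤ : ∀ n k → (∑[ w ∈ allVec k (allFin n) ] 2 ^ repeats w) ≤ (n + k) ^ k
∑-allVec-2^repeats≤ n zero    = ≤-refl
∑-allVec-2^repeats≤ n (suc k) = begin
  (∑[ w ∈ allVec (suc k) L ] 2 ^ repeats w)
    ≡⟨ ∑-concatMap-map _∷_ L V (λ w → 2 ^ repeats w) ⟩
  (∑[ x ∈ L ] ∑[ w ∈ V ] 2 ^ (1 ⊓ mult x w + repeats w))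
    ≡⟨ ∑-cong L (λ x → ∑-cong V (λ w → ^-distribˡ-+-* 2 (1 ⊓ mult x w) (repeats w))) ⟩
  (∑[ x ∈ L ] ∑[ w ∈ V ] 2 ^ (1 ⊓ mult x w) * 2 ^ repeats w)
    ≡⟨ ∑-comm L V _ ⟩
  (∑[ w ∈ V ] ∑[ x ∈ L ] 2 ^ (1 ⊓ mult x w) * 2 ^ repeats w)
    ≡⟨ ∑-cong V (λ w → ∑-distribʳ-* L (2 ^ repeats w) (λ x → 2 ^ (1 ⊓ mult x w))) ⟩
  (∑[ w ∈ V ] (∑[ x ∈ L ] 2 ^ (1 ⊓ mult x w)) * 2 ^ repeats w)
    ≤⟨ ∑-mono-≤ V (λ w → *-monoˡ-≤ (2 ^ repeats w) (∑-2^[1⊓mult]≤ w)) ⟩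
  (∑[ w ∈ V ] (n + k) * 2 ^ repeats w)
    ≡⟨ ∑-distribˡ-* V (n + k) (λ w → 2 ^ repeats w) ⟩
  (n + k) * (∑[ w ∈ V ] 2 ^ repeats w)
    ≤⟨ *-monoʳ-≤ (n + k) (∑-allVec-2^repeats≤ n k) ⟩
  (n + k) ^ suc k
    ≤⟨ ^-monoˡ-≤ (suc k) (+-monoʳ-≤ n (n≤1+n k)) ⟩
  (n + suc k) ^ suc k ∎
  where
  open ≤-Reasoning
  L : List (Fin n)
  L = allFin n
  V : List (Vec (Fin n) k)
  V = allVec k L
  2^[1⊓m]≤1+m : ∀ m → 2 ^ (1 ⊓ m) ≤ 1 + m
  2^[1⊓m]≤1+m zero    = ≤-refl
  2^[1⊓m]≤1+m (suc m) = s≤s (s≤s z≤n)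
  ∑-2^[1⊓mult]≤ : ∀ (w : Vec (Fin n) k) → (∑[ x ∈ L ] 2 ^ (1 ⊓ mult x w)) ≤ n + k
  ∑-2^[1⊓mult]≤ w = begin
    (∑[ x ∈ L ] 2 ^ (1 ⊓ mult x w))   ≤⟨ ∑-mono-≤ L (λ x → 2^[1⊓m]≤1+m (mult x w)) ⟩
    (∑[ x ∈ L ] 1 + mult x w)         ≡⟨ ∑-distrib-+ L (λ _ → 1) (λ x → mult x w) ⟩
    (∑[ _ ∈ L ] 1) + (∑[ x ∈ L ] mult x w)
      ≡⟨ cong₂ _+_ (trans (sym (length≡∑1 L)) (length-allFin n)) (∑-mult n w) ⟩
    n + k ∎

∑-any≤ : ∀ (V : List Y) (L : List X) (P : Y → X → Bool) →
         (∑[ v ∈ V ] iverson (any (P v) L)) ≤ (∑[ u ∈ L ] ∑[ v ∈ V ] iverson (P v u))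
∑-any≤ V []      P = ≤-reflexive (∑-zero V)
∑-any≤ V (u ∷ L) P = begin
  (∑[ v ∈ V ] iverson (P v u ∨ any (P v) L))
    ≤⟨ ∑-mono-≤ V (λ v → iverson-∨ (P v u) (any (P v) L)) ⟩
  (∑[ v ∈ V ] iverson (P v u) + iverson (any (P v) L))
    ≡⟨ ∑-distrib-+ V _ _ ⟩
  (∑[ v ∈ V ] iverson (P v u)) + (∑[ v ∈ V ] iverson (any (P v) L))
    ≤⟨ +-monoʳ-≤ _ (∑-any≤ V L P) ⟩
  (∑[ v ∈ V ] iverson (P v u)) + (∑[ u′ ∈ L ] ∑[ v ∈ V ] iverson (P v u′)) ∎
  where open ≤-Reasoning

totalRepeats : ∀ {m n k} → (Fin m → Vec (Fin n) k) → ℕ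
totalRepeats {m} f = ∑[ u ∈ allFin m ] repeats (f u)

multIn≤totalRepeats : ∀ {m n k} (f : Fin m → Vec (Fin n) k) →
                      length (filterᵇ (hasMultIn f) (allFin n)) ≤ totalRepeats f
multIn≤totalRepeats {m} {n} f = begin
  length (filterᵇ (hasMultIn f) (allFin n))
    ≡⟨ length-filterᵇ (hasMultIn f) (allFin n) ⟩
  (∑[ v ∈ allFin n ] iverson (hasMultIn f v))
    ≤⟨ ∑-any≤ (allFin n) (allFin m) (λ v u → does (2 ≤? mult v (f u))) ⟩
  (∑[ u ∈ allFin m ] ∑[ v ∈ allFin n ] iverson (does (2 ≤? mult v (f u))))
    ≤⟨ ∑-mono-≤ (allFin m) (multiples≤repeats ∘ f) ⟩
  totalRepeats f ∎
  where open ≤-Reasoning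

numMultIn≤totalRepeats : ∀ {k a b} (D : KOut k a b) → numMultIn D ≤ totalRepeats (proj₁ D) + totalRepeats (proj₂ D)
numMultIn≤totalRepeats (f , g) = +-mono-≤ (multIn≤totalRepeats f) (multIn≤totalRepeats g)

∑-allFun-2^totalRepeats≤ : ∀ k m n → (∑[ f ∈ allFun m (allVec k (allFin n)) ] 2 ^ totalRepeats f) ≤ (n + k) ^ (k * m)
∑-allFun-2^totalRepeats≤ k m n = begin
  (∑[ f ∈ allFun m (allVec k (allFin n)) ] 2 ^ totalRepeats f) ≡⟨ ∑-allFun-^ 2 m (allVec k (allFin n)) repeats ⟩
  (∑[ w ∈ allVec k (allFin n) ] 2 ^ repeats w) ^ m             ≤⟨ ^-monoˡ-≤ m (∑-allVec-2^repeats≤ n k) ⟩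
  ((n + k) ^ k) ^ m                                             ≡⟨ ^-*-assoc (n + k) k m ⟩
  (n + k) ^ (k * m)                                             ∎
  where open ≤-Reasoning

∑-allKOut-2^totalRepeats≤ : ∀ k a b →
  (∑[ D ∈ allKOut k a b ] 2 ^ (totalRepeats (proj₁ D) + totalRepeats (proj₂ D))) ≤ (b + k) ^ (k * a) * (a + k) ^ (k * b)
∑-allKOut-2^totalRepeats≤ k a b = begin
  (∑[ D ∈ allKOut k a b ] 2 ^ (totalRepeats (proj₁ D) + totalRepeats (proj₂ D)))
    ≡⟨ ∑-cong (allKOut k a b) (λ D → ^-distribˡ-+-* 2 (totalRepeats (proj₁ D)) (totalRepeats (proj₂ D))) ⟩
  (∑[ D ∈ allKOut k a b ] 2 ^ totalRepeats (proj₁ D) * 2 ^ totalRepeats (proj₂ D))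
    ≡⟨ ∑-cartesianProduct (allFun a (allVec k (allFin b))) (allFun b (allVec k (allFin a))) _ _ ⟩
  (∑[ f ∈ allFun a (allVec k (allFin b)) ] 2 ^ totalRepeats f) * (∑[ g ∈ allFun b (allVec k (allFin a)) ] 2 ^ totalRepeats g)
    ≤⟨ *-mono-≤ (∑-allFun-2^totalRepeats≤ k a b) (∑-allFun-2^totalRepeats≤ k b a) ⟩
  (b + k) ^ (k * a) * (a + k) ^ (k * b) ∎
  where open ≤-Reasoning

markov-^ : ∀ m .{{_ : NonZero m}} (E : X → Bool) (W : X → ℕ) t (L : List X) → (∀ x → E x ≡ true → t ≤ W x) →
           length (filterᵇ E L) * m ^ t ≤ (∑[ x ∈ L ] m ^ W x)
markov-^ m E W t []      E⇒t≤W = z≤n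
markov-^ m E W t (x ∷ L) E⇒t≤W with E x in Ex
... | true  = +-mono-≤ (^-monoʳ-≤ m (E⇒t≤W x Ex)) (markov-^ m E W t L E⇒t≤W)
... | false = ≤-trans (markov-^ m E W t L E⇒t≤W) (m≤n+m _ (m ^ W x))

-- (y + d)^(1+m) − y^(1+m) = d · ∑_{i ≤ m} (y + d)^i y^(m−i), and each summand is at most (y + d)^m.
^-mean-value : ∀ y d m → (y + d) ^ suc m ≤ y ^ suc m + suc m * d * (y + d) ^ m
^-mean-value y d zero    = ≤-reflexive (expand y d)
  where
  expand : ∀ y d → (y + d) * 1 ≡ y * 1 + 1 * d * 1
  expand = solve-∀
^-mean-value y d (suc m) = begin
  (y + d) * P′                                   ≡⟨ *-distribʳ-+ P′ y d ⟩
  y * P′ + d * P′                                ≤⟨ +-monoˡ-≤ (d * P′) (*-monoʳ-≤ y (^-mean-value y d m)) ⟩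
  y * (y ^ suc m + suc m * d * P) + d * P′       ≡⟨ cong (_+ d * P′) (distribute y (y ^ suc m) m d P) ⟩
  y ^ suc (suc m) + suc m * d * (y * P) + d * P′ ≤⟨ +-monoˡ-≤ (d * P′) (+-monoʳ-≤ (y ^ suc (suc m))
                                                      (*-monoʳ-≤ (suc m * d) (*-monoˡ-≤ P (m≤m+n y d)))) ⟩
  y ^ suc (suc m) + suc m * d * P′ + d * P′      ≡⟨ collect (y ^ suc (suc m)) m d P′ ⟩
  y ^ suc (suc m) + suc (suc m) * d * P′         ∎
  where
  open ≤-Reasoning
  P P′ : ℕ
  P  = (y + d) ^ m
  P′ = (y + d) ^ suc m
  distribute : ∀ y Y m d P → y * (Y + suc m * d * P) ≡ y * Y + suc m * d * (y * P)
  distribute = solve-∀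
  collect : ∀ Y m d P → Y + suc m * d * P + d * P ≡ Y + suc (suc m) * d * P
  collect = solve-∀

^-+-≤-2*^ : ∀ y d h → 2 * h * d ≤ y → (y + d) ^ h ≤ 2 * y ^ h
^-+-≤-2*^ y d zero    _      = s≤s z≤n
^-+-≤-2*^ y d (suc m) 2hd≤y = +-cancelʳ-≤ P′ P′ (2 * y ^ suc m) (begin
  P′ + P′                                ≡⟨ cong (P′ +_) (sym (+-identityʳ P′)) ⟩
  2 * P′                                 ≤⟨ *-monoʳ-≤ 2 (^-mean-value y d m) ⟩
  2 * (y ^ suc m + suc m * d * P)        ≡⟨ distribute (y ^ suc m) m d P ⟩
  2 * y ^ suc m + 2 * suc m * d * P      ≤⟨ +-monoʳ-≤ (2 * y ^ suc m) (*-monoˡ-≤ P 2hd≤y) ⟩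
  2 * y ^ suc m + y * P                  ≤⟨ +-monoʳ-≤ (2 * y ^ suc m) (*-monoˡ-≤ P (m≤m+n y d)) ⟩
  2 * y ^ suc m + P′                     ∎)
  where
  open ≤-Reasoning
  P P′ : ℕ
  P  = (y + d) ^ m
  P′ = (y + d) ^ suc m
  distribute : ∀ Y m d P → 2 * (Y + suc m * d * P) ≡ 2 * Y + 2 * suc m * d * P
  distribute = solve-∀

^-+-≤-2^*^ : ∀ y d h c n → 2 * h * d ≤ y → n ≤ c * h → (y + d) ^ n ≤ 2 ^ c * y ^ n
^-+-≤-2^*^ y d h zero    zero 2hd≤y _ = s≤s z≤n
^-+-≤-2^*^ y d h (suc c) n    2hd≤y n≤ch with n ≤? h
... | yes n≤h = ≤-trans (^-+-≤-2*^ y d n (≤-trans (*-monoˡ-≤ d (*-monoʳ-≤ 2 n≤h)) 2hd≤y))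
                        (*-monoˡ-≤ (y ^ n) (*-monoʳ-≤ 2 (m^n>0 2 c)))
... | no  n≰h = begin
  (y + d) ^ n                      ≡⟨ cong ((y + d) ^_) n≡h+n′ ⟩
  (y + d) ^ (h + n′)               ≡⟨ ^-distribˡ-+-* (y + d) h n′ ⟩
  (y + d) ^ h * (y + d) ^ n′       ≤⟨ *-mono-≤ (^-+-≤-2*^ y d h 2hd≤y) (^-+-≤-2^*^ y d h c n′ 2hd≤y n′≤ch) ⟩
  2 * y ^ h * (2 ^ c * y ^ n′)     ≡⟨ *-interchange 2 (y ^ h) (2 ^ c) (y ^ n′) ⟩
  2 ^ suc c * (y ^ h * y ^ n′)     ≡⟨ cong (2 ^ suc c *_) (sym (^-distribˡ-+-* y h n′)) ⟩
  2 ^ suc c * y ^ (h + n′)         ≡⟨ cong (λ e → 2 ^ suc c * y ^ e) (sym n≡h+n′) ⟩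
  2 ^ suc c * y ^ n                ∎
  where
  open ≤-Reasoning
  n′ : ℕ
  n′ = n ∸ h
  n≡h+n′ : n ≡ h + n′
  n≡h+n′ = sym (m+[n∸m]≡n (<⇒≤ (≰⇒> n≰h)))
  n′≤ch : n′ ≤ c * h
  n′≤ch = ≤-trans (∸-monoˡ-≤ h n≤ch) (≤-reflexive (m+n∸m≡n h (c * h)))

/-bounds : ∀ m y .{{_ : NonZero m}} → m ≤ y → y / m * m ≤ y × y ≤ 2 * (y / m * m)
/-bounds m y m≤y = m/n*n≤m y m , (begin
  y                         ≡⟨ m≡m%n+[m/n]*n y m ⟩
  y % m + q                 ≤⟨ +-monoˡ-≤ q (<⇒≤ (m%n<n y m)) ⟩
  m + q                     ≡⟨ cong (_+ q) (sym (*-identityˡ m)) ⟩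
  1 * m + q                 ≤⟨ +-monoˡ-≤ q (*-monoˡ-≤ m (m≥n⇒m/n>0 m≤y)) ⟩
  q + q                     ≡⟨ cong (q +_) (sym (+-identityʳ q)) ⟩
  2 * q                     ∎)
  where
  open ≤-Reasoning
  q : ℕ
  q = y / m * m

^-+-≤-2^[4de]*^ : ∀ y d e n .{{_ : NonZero d}} → 2 * d ≤ y → n ≤ e * y → (y + d) ^ n ≤ 2 ^ (4 * d * e) * y ^ n
^-+-≤-2^[4de]*^ y d e n 2d≤y n≤ey = ^-+-≤-2^*^ y d h (4 * d * e) n 2hd≤y n≤4deh
  where
  instance
    2d≢0 : NonZero (2 * d)
    2d≢0 = m*n≢0 2 d
  h : ℕ
  h = y / (2 * d)
  bounds : h * (2 * d) ≤ y × y ≤ 2 * (h * (2 * d))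
  bounds = /-bounds (2 * d) y 2d≤y
  reassoc : ∀ h d → h * (2 * d) ≡ 2 * h * d
  reassoc = solve-∀
  reassoc′ : ∀ e h d → e * (2 * (h * (2 * d))) ≡ 4 * d * e * h
  reassoc′ = solve-∀
  2hd≤y : 2 * h * d ≤ y
  2hd≤y = subst (_≤ y) (reassoc h d) (proj₁ bounds)
  n≤4deh : n ≤ 4 * d * e * h
  n≤4deh = ≤-trans n≤ey (≤-trans (*-monoʳ-≤ e (proj₂ bounds)) (≤-reflexive (reassoc′ e h d)))

n≤n^2 : ∀ n → n ≤ n ^ 2
n≤n^2 zero    = z≤n
n≤n^2 (suc n) = m≤m*n (suc n) (suc n * 1)

cube-root-≤ : ∀ {N n r} → r ^ 3 ≤ N → N ^ 2 < n ^ 3 → r ≤ n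
cube-root-≤ {N} {n} {r} r³≤N N²<n³ = ≮⇒≥ λ n<r → <⇒≱ r³<n³ (^-monoˡ-≤ 3 (<⇒≤ n<r))
  where
  r³<n³ : r ^ 3 < n ^ 3
  r³<n³ = ≤-<-trans (≤-trans r³≤N (n≤n^2 N)) N²<n³

large-multIn-tail : ∀ k l u N a b r → 2 * suc k * l < N →
  N ≤ l * a → a ≤ u * N → N ≤ l * b → b ≤ u * N → r ^ 3 ≤ N →
  let K = suc k ; c = 4 * K * (K * u * l) in
  countWhere K a b (λ D → N ^ 2 <ᵇ numMultIn D ^ 3) * 2 ^ r ≤ 2 ^ c * 2 ^ c * total K a b
large-multIn-tail k l u N a b r 2Kl<N N≤la a≤uN N≤lb b≤uN r³≤N = begin
  length (filterᵇ large (allKOut K a b)) * 2 ^ r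
    ≤⟨ markov-^ 2 large R r (allKOut K a b) large⇒r≤R ⟩
  (∑[ D ∈ allKOut K a b ] 2 ^ R D)
    ≤⟨ ∑-allKOut-2^totalRepeats≤ K a b ⟩
  (b + K) ^ (K * a) * (a + K) ^ (K * b)
    ≤⟨ *-mono-≤ (side N≤lb a≤uN) (side N≤la b≤uN) ⟩
  2 ^ c * b ^ (K * a) * (2 ^ c * a ^ (K * b))
    ≡⟨ *-interchange (2 ^ c) (b ^ (K * a)) (2 ^ c) (a ^ (K * b)) ⟩
  2 ^ c * 2 ^ c * (b ^ (K * a) * a ^ (K * b))
    ≡⟨ cong (2 ^ c * 2 ^ c *_) (sym (total≡ K a b)) ⟩
  2 ^ c * 2 ^ c * total K a b ∎
  where
  open ≤-Reasoning
  K c : ℕ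
  K = suc k
  c = 4 * K * (K * u * l)
  large : KOut K a b → Bool
  large D = N ^ 2 <ᵇ numMultIn D ^ 3
  R : KOut K a b → ℕ
  R D = totalRepeats (proj₁ D) + totalRepeats (proj₂ D)
  large⇒r≤R : ∀ D → large D ≡ true → r ≤ R D
  large⇒r≤R D largeD = ≤-trans (cube-root-≤ r³≤N (<ᵇ⇒< (N ^ 2) _ (subst T (sym largeD) _))) (numMultIn≤totalRepeats D)
  side : ∀ {x y} → N ≤ l * y → x ≤ u * N → (y + K) ^ (K * x) ≤ 2 ^ c * y ^ (K * x)
  side {x} {y} N≤ly x≤uN = ^-+-≤-2^[4de]*^ y K (K * u * l) (K * x) 2K≤y Kx≤Kuly
    where
    reassoc : ∀ K u l y → K * (u * (l * y)) ≡ K * u * l * y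
    reassoc = solve-∀
    2K≤y : 2 * K ≤ y
    2K≤y = <⇒≤ (*-cancelˡ-< l (2 * K) y (<-≤-trans (subst (_< N) (*-comm (2 * K) l) 2Kl<N) N≤ly))
    Kx≤Kuly : K * x ≤ K * u * l * y
    Kx≤Kuly = ≤-trans (*-monoʳ-≤ K (≤-trans x≤uN (*-monoʳ-≤ u N≤ly))) (≤-reflexive (reassoc K u l y))

mainTheorem6 : ∀ (k : ℕ) → 1 ≤ k →
    ∀ (l u : ℕ) →
    Σ ℕ λ N₀ → Σ ℕ λ q → Σ ℕ λ C →
      ∀ (N a b : ℕ) → N₀ ≤ N →
        N ≤ l * a → a ≤ u * N → N ≤ l * b → b ≤ u * N →
        ∀ (r : ℕ) → r ^ 3 ≤ N →
          countWhere k a b (λ D → (N ^ 2) <ᵇ (numMultIn D ^ 3)) * 2 ^ (r / suc q)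
            ≤ C * total k a b
mainTheorem6 (suc k) _ l u = suc (2 * suc k * l) , 0 , 2 ^ c * 2 ^ c ,
  λ N a b 2Kl<N N≤la a≤uN N≤lb b≤uN r r³≤N →
    large-multIn-tail k l u N a b (r / 1) 2Kl<N N≤la a≤uN N≤lb b≤uN
                      (subst (λ t → t ^ 3 ≤ N) (sym (n/1≡n r)) r³≤N)
  where
  c : ℕ
  c = 4 * suc k * (suc k * u * l)
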